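{- Consider CAUTC instances with binary utilities $u_i(j)\in\{0,1\}$, one credit per course, and arbitrary credit caps $C_i$. Let the following algorithm be run: sort the courses by non-decreasing end time; start with $A_s=\emptyset$ for all students; for each course $j$ in this order, let $T$ be the set of students $s$ with $u_s(j)=1$, $|A_s|<C_s$, and no course in $A_s$ overlapping $j$; if $T\neq\emptyset$, add $j$ to $A_s$ for some $s\in T$ minimizing $|A_s|$ (ties broken arbitrarily). Then the output allocation $(A_1,\dots,A_n)$ is EF1-CC: letting $D$ be the set of courses left unassigned, for every student $i$ with $|A_i|<C_i$ we have (a) for every student $i'$, $|\{j\in A_i: u_i(j)>0\}|\ge|\{j\in A_{i'}: u_i(j)>0\}|-1$, and (b) $|\{j\in A_i: u_i(j)>0\}|\ge|MIS_i|-1$, where $MIS_i$ is a maximum-cardinality set of pairwise non-overlapping courses in $\{j\in D: u_i(j)>0\}$.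
   Context: CAUTC model: $n$ students and $m$ courses. Student $i$ has utility $u_i(j)$ for course $j$ and a credit cap $C_i$. Each course has one credit, a single seat (a course with several seats is modeled as several identical courses), and a time interval given by integer start and end times; two courses overlap iff their intervals overlap strictly. A feasible allocation gives each student $i$ a set $A_i$, pairwise disjoint, with $|A_i|\le C_i$ and no two overlapping courses in any $A_i$. In EF1-CC, students who have reached their credit cap ($|A_i|=C_i$) are considered not to envy anyone; the unassigned courses $D$ are thought of as held by a dummy "charity" student. -}

module Defs where

open import Data.Nat using (ℕ; zero; suc; _≤_; _<_; _+_)
open import Data.Integer as ℤ using (ℤ)
open import Data.Fin using (Fin; _≟_)
open import Data.Bool using (Bool; true; false; if_then_else_)
open import Data.List using (List; []; _∷_; length; allFin)
open import Data.List.Membership.Propositional using (_∈_; _∉_)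
open import Data.List.Relation.Unary.AllPairs using (AllPairs)
open import Data.List.Relation.Unary.Unique.Propositional using (Unique)
open import Data.List.Relation.Unary.Linked using (Linked)
open import Data.List.Relation.Binary.Permutation.Propositional using (_↭_)
open import Data.Product using (_×_; Σ; ∃-syntax)
open import Data.Sum using (_⊎_)
open import Relation.Binary.PropositionalEquality using (_≡_)
open import Relation.Nullary using (¬_; does)

-- A CAUTC instance with binary utilities and one credit per course.
-- Students are Fin n, courses are Fin m (a course with several seats is
-- modelled as several identical courses).
record Instance (n m : ℕ) : Set where
  field
    u     : Fin n → Fin m → Bool
    cap   : Fin n → ℕ
    start : Fin m → ℤ
    end   : Fin m → ℤ
    valid : ∀ j → start j ℤ.< end j

module _ {n m : ℕ} (I : Instance n m) where
  open Instance I

  Overlap : Fin m → Fin m → Set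
  Overlap a b = (start a ℤ.< end b) × (start b ℤ.< end a)

  Alloc : Set
  Alloc = Fin n → List (Fin m)

  empty : Alloc
  empty _ = []

  addTo : Alloc → Fin n → Fin m → Alloc
  addTo A s j s' = if does (s' ≟ s) then j ∷ A s else A s'

  liked : Fin n → List (Fin m) → ℕ
  liked i [] = 0
  liked i (j ∷ js) = if u i j then suc (liked i js) else liked i js

  Eligible : Alloc → Fin m → Fin n → Set
  Eligible A j s = (u s j ≡ true) × (length (A s) < cap s) × (∀ k → k ∈ A s → ¬ Overlap j k)

  data Step (A : Alloc) (j : Fin m) : Alloc → Set where
    skip   : (∀ s → ¬ Eligible A j s) → Step A j A
    assign : (s : Fin n) → Eligible A j s →
             (∀ s' → Eligible A j s' → length (A s) ≤ length (A s')) →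
             Step A j (addTo A s j)

  data Run : Alloc → List (Fin m) → Alloc → Set where
    done : ∀ {A} → Run A [] A
    next : ∀ {A B C j js} → Step A j B → Run B js C → Run A (j ∷ js) C

  SortedByEnd : List (Fin m) → Set
  SortedByEnd ord = (ord ↭ allFin m) × Linked (λ a b → end a ℤ.≤ end b) ord

  GreedyOutput : Alloc → Set
  GreedyOutput A = Σ (List (Fin m)) λ ord → SortedByEnd ord × Run empty ord A

  Unassigned : Alloc → Fin m → Set
  Unassigned A j = ∀ s → j ∉ A s

  IndepLikedUnassigned : Alloc → Fin n → List (Fin m) → Set
  IndepLikedUnassigned A i M =
    Unique M × AllPairs (λ a b → ¬ Overlap a b) M ×
    (∀ j → j ∈ M → Unassigned A j × u i j ≡ true)

  IsMIS : Alloc → Fin n → List (Fin m) → Set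
  IsMIS A i M = IndepLikedUnassigned A i M ×
    (∀ M' → IndepLikedUnassigned A i M' → length M' ≤ length M)

  -- EF1-CC (with binary utilities): "x ≥ y - 1" is written y ≤ x + 1
  EF1-CC : Alloc → Set
  EF1-CC A = ∀ i → length (A i) < cap i →
    (∀ i' → liked i (A i') ≤ liked i (A i) + 1) ×
    (∀ M → IsMIS A i M → length M ≤ liked i (A i) + 1)

-- Sorting by end time makes every course held before step j end no later
-- than j.  If a course j liked by an unsaturated
-- student i is never assigned, some course already held by i overlaps j and
-- ends by the end of j, so it "blocks" j; a course blocks at most one member
-- of a set of pairwise non-overlapping courses, so |MIS_i| ≤ |A_i|.  For the
-- envy bound, fix i ≠ i' with i unsaturated and maintain: i' holds at most
-- |A_i| courses liked by i, or at most |A_i| + 1 and every course of A_i ends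
-- no later than some course of A_{i'}.  When i' receives a course j liked by
-- i, either i was eligible too (so |A_{i'}| ≤ |A_i| by the least-loaded rule),
-- or a course of A_i overlaps j; in the second case, under dominance, the
-- dominating course of A_{i'} would overlap j as well, contradicting the
-- eligibility of i'.
module Submission where

open import Defs
open import Data.Nat using (ℕ; suc; _≤_; _<_; _+_; z≤n; s≤s)
open import Data.Nat.Properties using (≤-refl; ≤-trans; n≤1+n; m≤n⇒m≤1+n; +-comm; +-suc; +-mono-≤; module ≤-Reasoning)
import Data.Integer as ℤ
import Data.Integer.Properties as ℤ
open import Data.Fin using (Fin; _≟_)
open import Data.Bool using (true; false)
open import Data.List using (List; []; _∷_; length; filter)
open import Data.List.Membership.Propositional using (_∈_; find; lose)
open import Data.List.Membership.Propositional.Properties using (∈-filter⁻; ∈-allFin)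
open import Data.List.Relation.Binary.Subset.Propositional using (_⊆_)
open import Data.List.Relation.Unary.Any using (here; there; any?)
open import Data.List.Relation.Unary.All as All using ([]; _∷_)
open import Data.List.Relation.Unary.AllPairs as AllPairs using (AllPairs; []; _∷_)
import Data.List.Relation.Unary.AllPairs.Properties as AllPairsₚ
open import Data.List.Relation.Unary.Linked as Linked using (Linked)
open import Data.List.Relation.Unary.Linked.Properties using (Linked⇒AllPairs)
open import Data.List.Relation.Binary.Permutation.Propositional using (↭-sym)
open import Data.List.Relation.Binary.Permutation.Propositional.Properties using (∈-resp-↭)
open import Data.Product as Product using (_×_; _,_; proj₁; proj₂; ∃-syntax)
open import Data.Sum as Sum using (_⊎_; inj₁; inj₂; [_,_])
open import Data.Empty using (⊥-elim)
open import Relation.Binary.PropositionalEquality using (_≡_; _≢_; refl; sym; trans; cong; subst)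
open import Relation.Nullary using (¬_; Dec; yes; no)
open import Relation.Nullary.Decidable using (_×-dec_)
open import Relation.Unary.Properties using (∁?)

module _ {a} {X : Set a} {p} {P : X → Set p} (P? : ∀ x → Dec (P x)) where

  length-filter+filter-∁ : ∀ xs → length (filter P? xs) + length (filter (∁? P?) xs) ≡ length xs
  length-filter+filter-∁ [] = refl
  length-filter+filter-∁ (x ∷ xs) with P? x
  ... | yes _ = cong suc (length-filter+filter-∁ xs)
  ... | no _ = trans (+-suc (length (filter P? xs)) _) (cong suc (length-filter+filter-∁ xs))

module _ {a b r s} {X : Set a} {Y : Set b} {R : X → Y → Set r} (R? : ∀ x y → Dec (R x y))
         {S : X → X → Set s} (exclusive : ∀ {x x' y} → R x y → R x' y → ¬ S x x') where

  length-≤1-of-common-witness : ∀ {y} xs → AllPairs S xs → (∀ {x} → x ∈ xs → R x y) → length xs ≤ 1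
  length-≤1-of-common-witness [] _ _ = z≤n
  length-≤1-of-common-witness (_ ∷ []) _ _ = s≤s z≤n
  length-≤1-of-common-witness (_ ∷ _ ∷ _) ((Sxx' ∷ _) ∷ _) w =
    ⊥-elim (exclusive (w (here refl)) (w (there (here refl))) Sxx')

  length-≤-of-exclusive-witnesses : ∀ ys xs → AllPairs S xs →
    (∀ {x} → x ∈ xs → ∃[ y ] y ∈ ys × R x y) → length xs ≤ length ys
  length-≤-of-exclusive-witnesses [] [] _ _ = z≤n
  length-≤-of-exclusive-witnesses [] (_ ∷ _) _ w with w (here refl)
  ... | _ , () , _
  length-≤-of-exclusive-witnesses (y ∷ ys) xs sep w = begin
    length xs                                       ≡⟨ sym (length-filter+filter-∁ R?y xs) ⟩
    length (filter R?y xs) + length (filter (∁? R?y) xs)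
      ≤⟨ +-mono-≤ (length-≤1-of-common-witness (filter R?y xs) (AllPairsₚ.filter⁺ R?y sep)
                                                (λ x∈ → proj₂ (∈-filter⁻ R?y {xs = xs} x∈)))
                  (length-≤-of-exclusive-witnesses ys (filter (∁? R?y) xs)
                                                (AllPairsₚ.filter⁺ (∁? R?y) sep) other-witness) ⟩
    1 + length ys                                   ∎
    where
    open ≤-Reasoning
    R?y : ∀ x → Dec (R x y)
    R?y x = R? x y
    other-witness : ∀ {x} → x ∈ filter (∁? R?y) xs → ∃[ y' ] y' ∈ ys × R x y'
    other-witness x∈ with ∈-filter⁻ (∁? R?y) {xs = xs} x∈
    ... | x∈xs , ¬Rxy with w x∈xs
    ...   | _ , here refl , Rxy = ⊥-elim (¬Rxy Rxy)
    ...   | y' , there y'∈ , Rxy' = y' , y'∈ , Rxy'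

module _ {n m : ℕ} (I : Instance n m) where
  open Instance I

  EndsBy : Fin m → Fin m → Set
  EndsBy k j = end k ℤ.≤ end j

  overlap? : ∀ j k → Dec (Overlap I j k)
  overlap? j k = (start j ℤ.<? end k) ×-dec (start k ℤ.<? end j)

  Blocks : Fin m → Fin m → Set
  Blocks j k = start j ℤ.< end k × EndsBy k j

  blocks? : ∀ j k → Dec (Blocks j k)
  blocks? j k = (start j ℤ.<? end k) ×-dec (end k ℤ.≤? end j)

  blocks⇒overlap : ∀ {j k} → Blocks j k → Overlap I j k
  blocks⇒overlap {k = k} (j<k , k≤j) = j<k , ℤ.<-≤-trans (valid k) k≤j

  common-blocker⇒overlap : ∀ {j j' k} → Blocks j k → Blocks j' k → Overlap I j j'
  common-blocker⇒overlap (j<k , k≤j) (j'<k , k≤j') = ℤ.<-≤-trans j<k k≤j' , ℤ.<-≤-trans j'<k k≤j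

  liked-≤-length : ∀ i xs → liked I i xs ≤ length xs
  liked-≤-length i [] = z≤n
  liked-≤-length i (x ∷ xs) with u i x
  ... | true = s≤s (liked-≤-length i xs)
  ... | false = m≤n⇒m≤1+n (liked-≤-length i xs)

  liked-≡-length : ∀ i xs → (∀ {k} → k ∈ xs → u i k ≡ true) → liked I i xs ≡ length xs
  liked-≡-length i [] _ = refl
  liked-≡-length i (x ∷ xs) all-liked with u i x | all-liked (here refl)
  ... | true | _ = cong suc (liked-≡-length i xs (λ k∈ → all-liked (there k∈)))

  addTo-self : ∀ A s j → addTo I A s j s ≡ j ∷ A s
  addTo-self A s j with s ≟ s
  ... | yes _ = refl
  ... | no s≢s = ⊥-elim (s≢s refl)

  addTo-other : ∀ A s j {s'} → s' ≢ s → addTo I A s j s' ≡ A s'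
  addTo-other A s j {s'} s'≢s with s' ≟ s
  ... | yes s'≡s = ⊥-elim (s'≢s s'≡s)
  ... | no _ = refl

  ∈-addTo⁺ : ∀ A s j {s'} → A s' ⊆ addTo I A s j s'
  ∈-addTo⁺ A s j {s'} k∈ with s' ≟ s
  ... | yes refl = there k∈
  ... | no _ = k∈

  ∈-addTo⁻ : ∀ A s j {s' k} → k ∈ addTo I A s j s' → (s' ≡ s × k ≡ j) ⊎ k ∈ A s'
  ∈-addTo⁻ A s j {s'} k∈ with s' ≟ s
  ∈-addTo⁻ A s j (here k≡j) | yes s'≡s = inj₁ (s'≡s , k≡j)
  ∈-addTo⁻ A s j (there k∈) | yes refl = inj₂ k∈
  ∈-addTo⁻ A s j k∈ | no _ = inj₂ k∈

  length-addTo : ∀ A s j s' → length (A s') ≤ length (addTo I A s j s')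
  length-addTo A s j s' with s' ≟ s
  ... | yes refl = n≤1+n _
  ... | no _ = ≤-refl

  overlap-or-eligible : ∀ {A j s} → u s j ≡ true → length (A s) < cap s →
    (∃[ k ] k ∈ A s × Overlap I j k) ⊎ Eligible I A j s
  overlap-or-eligible {A} {j} {s} usj unsat with any? (overlap? j) (A s)
  ... | yes overlapping = inj₁ (find overlapping)
  ... | no disjoint = inj₂ (usj , unsat , λ _ k∈ ov → disjoint (lose k∈ ov))

  step-⊆ : ∀ {A B j} → Step I A j B → ∀ s → A s ⊆ B s
  step-⊆ (skip _) s k∈ = k∈
  step-⊆ {A} {j = j} (assign t _ _) s = ∈-addTo⁺ A t j

  step-∈⁻ : ∀ {A B j s k} → Step I A j B → k ∈ B s → k ∈ A s ⊎ (k ≡ j × Eligible I A j s)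
  step-∈⁻ (skip _) k∈ = inj₁ k∈
  step-∈⁻ {A} {j = j} (assign t elig _) k∈ with ∈-addTo⁻ A t j k∈
  ... | inj₁ (refl , refl) = inj₂ (refl , elig)
  ... | inj₂ k∈A = inj₁ k∈A

  step-length-≤ : ∀ {A B j} → Step I A j B → ∀ s → length (A s) ≤ length (B s)
  step-length-≤ (skip _) s = ≤-refl
  step-length-≤ {A} {j = j} (assign t _ _) s = length-addTo A t j s

  run-preserves : (P : Alloc I → Set) → (∀ {A B j} → Step I A j B → P A → P B) →
    ∀ {A js C} → Run I A js C → P A → P C
  run-preserves P step done p = p
  run-preserves P step (next st r) p = run-preserves P step r (step st p)

  run-⊆ : ∀ {A js C} → Run I A js C → ∀ s → A s ⊆ C s
  run-⊆ r s {k} = run-preserves (λ B → k ∈ B s) (λ st → step-⊆ st s) r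

  run-length-≤ : ∀ {A js C} → Run I A js C → ∀ s → length (A s) ≤ length (C s)
  run-length-≤ {A} r s =
    run-preserves (λ B → length (A s) ≤ length (B s)) (λ st le → ≤-trans le (step-length-≤ st s)) r ≤-refl

  EndsBefore : Alloc I → Fin m → Set
  EndsBefore A j = ∀ s {k} → k ∈ A s → EndsBy k j

  EndsBeforeAll : Alloc I → List (Fin m) → Set
  EndsBeforeAll A js = ∀ {j} → j ∈ js → EndsBefore A j

  step-endsBeforeAll : ∀ {A B j js} → Step I A j B → Linked EndsBy (j ∷ js) →
    EndsBeforeAll A (j ∷ js) → EndsBeforeAll B js
  step-endsBeforeAll st sorted before j'∈ s k∈ with step-∈⁻ st k∈
  ... | inj₁ k∈A = before (there j'∈) s k∈A
  ... | inj₂ (refl , _) = All.lookup (AllPairs.head (Linked⇒AllPairs ℤ.≤-trans sorted)) j'∈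

  sorted-run-preserves : (P : Alloc I → Set) → (∀ {A B j} → Step I A j B → EndsBefore A j → P A → P B) →
    ∀ {A js C} → Run I A js C → Linked EndsBy js → EndsBeforeAll A js → P A → P C
  sorted-run-preserves P step done _ _ p = p
  sorted-run-preserves P step (next st r) sorted before p =
    sorted-run-preserves P step r (Linked.tail sorted) (step-endsBeforeAll st sorted before)
      (step st (before (here refl)) p)

  greedy-preserves : (P : Alloc I → Set) → P (empty I) →
    (∀ {A B j} → Step I A j B → EndsBefore A j → P A → P B) →
    ∀ {C} → GreedyOutput I C → P C
  greedy-preserves P p₀ step (_ , (_ , sorted) , run) =
    sorted-run-preserves P step run sorted (λ _ _ ()) p₀

  HoldsLiked : Alloc I → Set
  HoldsLiked A = ∀ s {k} → k ∈ A s → u s k ≡ true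

  greedy-holdsLiked : ∀ {C} → GreedyOutput I C → HoldsLiked C
  greedy-holdsLiked = greedy-preserves HoldsLiked (λ _ ()) step
    where
    step : ∀ {A B j} → Step I A j B → EndsBefore A j → HoldsLiked A → HoldsLiked B
    step st _ held s k∈ with step-∈⁻ st k∈
    ... | inj₁ k∈A = held s k∈A
    ... | inj₂ (refl , elig) = proj₁ elig

  step-unassigned⇒blocked : ∀ {A B j i} → Step I A j B → EndsBefore A j → Unassigned I B j →
    u i j ≡ true → length (A i) < cap i → ∃[ k ] k ∈ A i × Blocks j k
  step-unassigned⇒blocked {A} {i = i} (skip ineligible) before _ uij unsat
    with overlap-or-eligible {A} uij unsat
  ... | inj₁ (k , k∈ , ov) = k , k∈ , proj₁ ov , before i k∈
  ... | inj₂ elig = ⊥-elim (ineligible i elig)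
  step-unassigned⇒blocked {A} {j = j} (assign t _ _) _ unassigned _ _ =
    ⊥-elim (unassigned t (subst (j ∈_) (sym (addTo-self A t j)) (here refl)))

  run-unassigned⇒blocked : ∀ {A js C j i} → Run I A js C → Linked EndsBy js → EndsBeforeAll A js →
    j ∈ js → Unassigned I C j → u i j ≡ true → length (C i) < cap i → ∃[ k ] k ∈ C i × Blocks j k
  run-unassigned⇒blocked {i = i} run@(next st r) _ before (here refl) unassigned uij unsat
    with step-unassigned⇒blocked st (before (here refl)) (λ s j∈ → unassigned s (run-⊆ r s j∈)) uij
           (≤-trans (s≤s (run-length-≤ run i)) unsat)
  ... | k , k∈ , blocks = k , run-⊆ run i k∈ , blocks
  run-unassigned⇒blocked (next st r) sorted before (there j∈) =
    run-unassigned⇒blocked r (Linked.tail sorted) (step-endsBeforeAll st sorted before) j∈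

  greedy-unassigned⇒blocked : ∀ {C j i} → GreedyOutput I C → Unassigned I C j →
    u i j ≡ true → length (C i) < cap i → ∃[ k ] k ∈ C i × Blocks j k
  greedy-unassigned⇒blocked {j = j} (_ , (ord↭all , sorted) , run) =
    run-unassigned⇒blocked run sorted (λ _ _ ()) (∈-resp-↭ (↭-sym ord↭all) (∈-allFin j))

  greedy-MIS-≤ : ∀ {C i M} → GreedyOutput I C → length (C i) < cap i →
    IndepLikedUnassigned I C i M → length M ≤ length (C i)
  greedy-MIS-≤ {C} {i} {M} greedy unsat (_ , independent , liked-unassigned) =
    length-≤-of-exclusive-witnesses blocks? (λ bj bj' disjoint → disjoint (common-blocker⇒overlap bj bj'))
      (C i) M independent
      (λ j∈ → greedy-unassigned⇒blocked greedy (proj₁ (liked-unassigned _ j∈))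
                (proj₂ (liked-unassigned _ j∈)) unsat)

  Dominated : List (Fin m) → List (Fin m) → Set
  Dominated xs ys = ∀ {k} → k ∈ xs → ∃[ k' ] k' ∈ ys × EndsBy k k'

  BoundedEnvy : Fin n → List (Fin m) → List (Fin m) → Set
  BoundedEnvy i xs ys = liked I i ys ≤ length xs ⊎ (liked I i ys ≤ suc (length xs) × Dominated xs ys)

  dominated-∷ : ∀ {xs ys} j → Dominated xs ys → Dominated xs (j ∷ ys)
  dominated-∷ _ dominated k∈ with dominated k∈
  ... | k' , k'∈ , k≤k' = k' , there k'∈ , k≤k'

  boundedEnvy⇒≤suc : ∀ {i xs ys} → BoundedEnvy i xs ys → liked I i ys ≤ suc (length xs)
  boundedEnvy⇒≤suc = [ m≤n⇒m≤1+n , proj₁ ]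

  boundedEnvy-owner-gains : ∀ {i xs ys} j → BoundedEnvy i xs ys → BoundedEnvy i (j ∷ xs) ys
  boundedEnvy-owner-gains _ envy = inj₁ (boundedEnvy⇒≤suc envy)

  boundedEnvy-rival-gains : ∀ {i xs ys j} → (∀ {k} → k ∈ xs → EndsBy k j) →
    (u i j ≡ true → liked I i ys ≤ length xs) → BoundedEnvy i xs ys → BoundedEnvy i xs (j ∷ ys)
  boundedEnvy-rival-gains {i} {j = j} before no-envy envy with u i j
  ... | true = inj₂ (s≤s (no-envy refl) , λ k∈ → j , here refl , before k∈)
  ... | false = Sum.map₂ (Product.map₂ (dominated-∷ j)) envy

  rival-not-envied : ∀ {A j i i'} → Eligible I A j i' →
    (∀ s → Eligible I A j s → length (A i') ≤ length (A s)) → EndsBefore A j →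
    u i j ≡ true → length (A i) < cap i → BoundedEnvy i (A i) (A i') → liked I i (A i') ≤ length (A i)
  rival-not-envied {A} {i = i} {i'} elig' least-loaded before uij unsat envy
    with overlap-or-eligible {A} uij unsat | envy
  ... | inj₂ elig | _ = ≤-trans (liked-≤-length i (A i')) (least-loaded i elig)
  ... | inj₁ _ | inj₁ le = le
  ... | inj₁ (k , k∈ , ov) | inj₂ (_ , dominated) with dominated k∈
  ...   | k' , k'∈ , k≤k' =
    ⊥-elim (proj₂ (proj₂ elig') k' k'∈ (blocks⇒overlap (ℤ.<-≤-trans (proj₁ ov) k≤k' , before i' k'∈)))

  step-boundedEnvy : ∀ {A B j i i'} → i ≢ i' → Step I A j B → EndsBefore A j →
    length (A i) < cap i → BoundedEnvy i (A i) (A i') → BoundedEnvy i (B i) (B i')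
  step-boundedEnvy _ (skip _) _ _ envy = envy
  step-boundedEnvy {A} {j = j} {i} {i'} i≢i' (assign s elig least-loaded) before unsat envy
    with s ≟ i
  ... | yes refl rewrite addTo-self A i j | addTo-other A i j (λ i'≡i → i≢i' (sym i'≡i)) =
    boundedEnvy-owner-gains j envy
  ... | no s≢i with s ≟ i'
  ...   | yes refl rewrite addTo-other A i' j i≢i' | addTo-self A i' j =
    boundedEnvy-rival-gains (before i)
      (λ uij → rival-not-envied elig least-loaded before uij unsat envy) envy
  ...   | no s≢i' rewrite addTo-other A s j (λ i≡s → s≢i (sym i≡s))
                        | addTo-other A s j (λ i'≡s → s≢i' (sym i'≡s)) = envy

  greedy-envy-≤ : ∀ {C i} → GreedyOutput I C → length (C i) < cap i →
    ∀ i' → liked I i (C i') ≤ suc (length (C i))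
  greedy-envy-≤ {C} {i} greedy unsat i' with i ≟ i'
  ... | yes refl = m≤n⇒m≤1+n (liked-≤-length i (C i))
  ... | no i≢i' = boundedEnvy⇒≤suc (greedy-preserves Invariant (λ _ → inj₁ z≤n) step greedy unsat)
    where
    Invariant : Alloc I → Set
    Invariant A = length (A i) < cap i → BoundedEnvy i (A i) (A i')
    step : ∀ {A B j} → Step I A j B → EndsBefore A j → Invariant A → Invariant B
    step {A} st before inv unsat-B = step-boundedEnvy i≢i' st before unsat-A (inv unsat-A)
      where
      unsat-A : length (A i) < cap i
      unsat-A = ≤-trans (s≤s (step-length-≤ st i)) unsat-B

mainTheorem8 : ∀ {n m : ℕ} (I : Instance n m) (A : Alloc I) →
    GreedyOutput I A → EF1-CC I A
mainTheorem8 I A greedy i unsat = envy-bound , charity-bound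
  where
  liked-own : liked I i (A i) ≡ length (A i)
  liked-own = liked-≡-length I i (A i) (greedy-holdsLiked I greedy i)

  envy-bound : ∀ i' → liked I i (A i') ≤ liked I i (A i) + 1
  envy-bound i' rewrite liked-own | +-comm (length (A i)) 1 = greedy-envy-≤ I greedy unsat i'

  charity-bound : ∀ M → IsMIS I A i M → length M ≤ liked I i (A i) + 1
  charity-bound M (independent , _) rewrite liked-own | +-comm (length (A i)) 1 =
    m≤n⇒m≤1+n (greedy-MIS-≤ I greedy unsat independent)
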